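{- For all terms $M, M'$, all values $V, V'$ and every variable $x$: if $M\Rightarrow_{int}M'$ and $V\Rightarrow_{int}V'$, then $M\{V/x\}\Rightarrow_{int}M'\{V'/x\}$.
   Context: Terms and values of the call-by-value $\lambda$-calculus are defined by mutual induction from a countably infinite set of variables: values $V ::= x \mid \lambda x.M$ and terms $M,N,L ::= V \mid MN$, up to $\alpha$-conversion, application associating to the left; $\mathrm{fv}(M)$ is the set of free variables and $M\{V/x\}$ capture-avoiding substitution of a value. In all rules below $m\ge0$ and $V,V'$ range over values. Parallel reduction $\Rightarrow$ is the least relation closed under: ($\beta_v$) if $V\Rightarrow V'$ and $M_i\Rightarrow M_i'$ for $0\le i\le m$ then $(\lambda x.M_0)VM_1\dots M_m\Rightarrow M_0'\{V'/x\}M_1'\dots M_m'$; ($\sigma_1$) if $N\Rightarrow N'$, $L\Rightarrow L'$, $M_i\Rightarrow M_i'$ for $0\le i\le m$, and $x\notin\mathrm{fv}(L)$, then $(\lambda x.M_0)NLM_1\dots M_m\Rightarrow(\lambda x.M_0'L')N'M_1'\dots M_m'$; ($\sigma_3$) if $V\Rightarrow V'$, $N\Rightarrow N'$, $L\Rightarrow L'$, $M_i\Rightarrow M_i'$ for $1\le i\le m$, and $x\notin\mathrm{fv}(V)$, then $V((\lambda x.L)N)M_1\dots M_m\Rightarrow(\lambda x.V'L')N'M_1'\dots M_m'$; ($\lambda$) if $M_i\Rightarrow M_i'$ for $0\le i\le m$ then $(\lambda x.M_0)M_1\dots M_m\Rightarrow(\lambda x.M_0')M_1'\dots M_m'$;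 (var) if $M_i\Rightarrow M_i'$ for $1\le i\le m$ then $xM_1\dots M_m\Rightarrow xM_1'\dots M_m'$. Internal parallel reduction $\Rightarrow_{int}$ is the least relation with: if $N\Rightarrow N'$ then $\lambda x.N\Rightarrow_{int}\lambda x.N'$; $x\Rightarrow_{int}x$; if $V\Rightarrow V'$, $N\Rightarrow_{int}N'$ and $M_i\Rightarrow M_i'$ for $1\le i\le m$, then $VNM_1\dots M_m\Rightarrow_{int}V'N'M_1'\dots M_m'$. -}

module Defs where

open import Data.Nat using (ℕ; zero; suc)
open import Data.Fin using (Fin; zero; suc; _≟_)
open import Data.List using (List; []; _∷_)
open import Relation.Nullary using (yes; no)

-- Well-scoped de Bruijn terms of the (call-by-value) λ-calculus;
-- a term of type Term n has its free variables among Fin n.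
-- α-equivalence is syntactic identity in this representation.
data Term (n : ℕ) : Set where
  var : Fin n → Term n
  lam : Term (suc n) → Term n
  app : Term n → Term n → Term n

data Value {n : ℕ} : Term n → Set where
  var : (x : Fin n) → Value (var x)
  lam : (M : Term (suc n)) → Value (lam M)

_·*_ : ∀ {n} → Term n → List (Term n) → Term n
M ·* []       = M
M ·* (N ∷ Ns) = app M N ·* Ns

extr : ∀ {n m} → (Fin n → Fin m) → Fin (suc n) → Fin (suc m)
extr ρ zero    = zero
extr ρ (suc i) = suc (ρ i)

rename : ∀ {n m} → (Fin n → Fin m) → Term n → Term m
rename ρ (var i)   = var (ρ i)
rename ρ (lam M)   = lam (rename (extr ρ) M)
rename ρ (app M N) = app (rename ρ M) (rename ρ N)

wk : ∀ {n} → Term n → Term (suc n)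
wk = rename suc

exts : ∀ {n m} → (Fin n → Term m) → Fin (suc n) → Term (suc m)
exts σ zero    = var zero
exts σ (suc i) = wk (σ i)

subst : ∀ {n m} → (Fin n → Term m) → Term n → Term m
subst σ (var i)   = σ i
subst σ (lam M)   = lam (subst (exts σ) M)
subst σ (app M N) = app (subst σ M) (subst σ N)

single : ∀ {n} → Term n → Fin n → Fin n → Term n
single V x y with y ≟ x
... | yes _ = V
... | no  _ = var y

_[_/_] : ∀ {n} → Term n → Term n → Fin n → Term n
M [ V / x ] = subst (single V x) M

_[_]₀ : ∀ {n} → Term (suc n) → Term n → Term n
M [ V ]₀ = subst σ M
  where
  σ : Fin _ → Term _
  σ zero    = V
  σ (suc i) = var i

infix 4 _⇒_ _⇒*_ _⇒int_

mutual
  data _⇒_ {n : ℕ} : Term n → Term n → Set where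
    βv  : ∀ {M₀ M₀' V V' Ms Ms'} → Value V →
          V ⇒ V' → M₀ ⇒ M₀' → Ms ⇒* Ms' →
          (app (lam M₀) V ·* Ms) ⇒ ((M₀' [ V' ]₀) ·* Ms')
    -- the side condition x ∉ fv(L) is built in: L lives outside the binder
    σ₁  : ∀ {M₀ M₀' N N' L L' Ms Ms'} →
          N ⇒ N' → L ⇒ L' → M₀ ⇒ M₀' → Ms ⇒* Ms' →
          (app (app (lam M₀) N) L ·* Ms) ⇒ (app (lam (app M₀' (wk L'))) N' ·* Ms')
    -- the side condition x ∉ fv(V) is built in: V lives outside the binder
    σ₃  : ∀ {V V' N N' L L' Ms Ms'} → Value V →
          V ⇒ V' → N ⇒ N' → L ⇒ L' → Ms ⇒* Ms' →
          (app V (app (lam L) N) ·* Ms) ⇒ (app (lam (app (wk V') L')) N' ·* Ms')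
    lamR : ∀ {M₀ M₀' Ms Ms'} → M₀ ⇒ M₀' → Ms ⇒* Ms' →
          (lam M₀ ·* Ms) ⇒ (lam M₀' ·* Ms')
    varR : ∀ {x Ms Ms'} → Ms ⇒* Ms' →
          (var x ·* Ms) ⇒ (var x ·* Ms')

  data _⇒*_ {n : ℕ} : List (Term n) → List (Term n) → Set where
    []  : [] ⇒* []
    _∷_ : ∀ {M M' Ms Ms'} → M ⇒ M' → Ms ⇒* Ms' → (M ∷ Ms) ⇒* (M' ∷ Ms')

data _⇒int_ {n : ℕ} : Term n → Term n → Set where
  lamI : ∀ {N N'} → N ⇒ N' → lam N ⇒int lam N'
  varI : ∀ {x} → var x ⇒int var x
  appI : ∀ {V V' N N' Ms Ms'} → Value V →
         V ⇒ V' → N ⇒int N' → Ms ⇒* Ms' →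
         (app V N ·* Ms) ⇒int (app V' N' ·* Ms')

module Submission where

-- We prove the statement for arbitrary simultaneous substitutions σ, σ'
-- that are pointwise related by parallel reduction *between values*
-- (σ ⇒σ σ'); the single substitution {V/x} is the special case in which
-- one entry is V ⇒v V' and all others are variables.

open import Defs
open import Data.Nat as ℕ using (ℕ)
open import Data.Fin using (Fin; zero; suc; _≟_)
open import Data.List using (List; []; _∷_; map)
open import Data.Empty using (⊥)
open import Function using (_∘_)
open import Relation.Nullary using (yes; no)
open import Relation.Binary.PropositionalEquality
  using (_≡_; _≗_; refl; cong; cong₂; sym; trans; subst₂; module ≡-Reasoning)

private
  variable
    n m k : ℕ

extr-cong : {ρ ρ' : Fin n → Fin m} → ρ ≗ ρ' → extr ρ ≗ extr ρ'
extr-cong e zero    = refl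
extr-cong e (suc i) = cong suc (e i)

rename-cong : {ρ ρ' : Fin n → Fin m} → ρ ≗ ρ' → rename ρ ≗ rename ρ'
rename-cong e (var i)   = cong var (e i)
rename-cong e (lam M)   = cong lam (rename-cong (extr-cong e) M)
rename-cong e (app M N) = cong₂ app (rename-cong e M) (rename-cong e N)

exts-cong : {σ σ' : Fin n → Term m} → σ ≗ σ' → exts σ ≗ exts σ'
exts-cong e zero    = refl
exts-cong e (suc i) = cong wk (e i)

subst-cong : {σ σ' : Fin n → Term m} → σ ≗ σ' → subst σ ≗ subst σ'
subst-cong e (var i)   = e i
subst-cong e (lam M)   = cong lam (subst-cong (exts-cong e) M)
subst-cong e (app M N) = cong₂ app (subst-cong e M) (subst-cong e N)

rename-rename : (ρ : Fin m → Fin k) (ρ' : Fin n → Fin m) →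
                rename ρ ∘ rename ρ' ≗ rename (ρ ∘ ρ')
rename-rename ρ ρ' (var i)   = refl
rename-rename ρ ρ' (lam M)   =
  cong lam (trans (rename-rename (extr ρ) (extr ρ') M) (rename-cong extr-extr M))
  where
  extr-extr : extr ρ ∘ extr ρ' ≗ extr (ρ ∘ ρ')
  extr-extr zero    = refl
  extr-extr (suc i) = refl
rename-rename ρ ρ' (app M N) = cong₂ app (rename-rename ρ ρ' M) (rename-rename ρ ρ' N)

subst-rename : (σ : Fin m → Term k) (ρ : Fin n → Fin m) →
               subst σ ∘ rename ρ ≗ subst (σ ∘ ρ)
subst-rename σ ρ (var i)   = refl
subst-rename σ ρ (lam M)   =
  cong lam (trans (subst-rename (exts σ) (extr ρ) M) (subst-cong exts-extr M))
  where
  exts-extr : exts σ ∘ extr ρ ≗ exts (σ ∘ ρ)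
  exts-extr zero    = refl
  exts-extr (suc i) = refl
subst-rename σ ρ (app M N) = cong₂ app (subst-rename σ ρ M) (subst-rename σ ρ N)

rename-wk : (ρ : Fin n → Fin m) (L : Term n) → rename (extr ρ) (wk L) ≡ wk (rename ρ L)
rename-wk ρ L = trans (rename-rename (extr ρ) suc L) (sym (rename-rename suc ρ L))

rename-subst : (ρ : Fin m → Fin k) (σ : Fin n → Term m) →
               rename ρ ∘ subst σ ≗ subst (rename ρ ∘ σ)
rename-subst ρ σ (var i)   = refl
rename-subst ρ σ (lam M)   =
  cong lam (trans (rename-subst (extr ρ) (exts σ) M) (subst-cong extr-exts M))
  where
  extr-exts : rename (extr ρ) ∘ exts σ ≗ exts (rename ρ ∘ σ)
  extr-exts zero    = refl
  extr-exts (suc i) = rename-wk ρ (σ i)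
rename-subst ρ σ (app M N) = cong₂ app (rename-subst ρ σ M) (rename-subst ρ σ N)

subst-wk : (σ : Fin n → Term m) (L : Term n) → subst (exts σ) (wk L) ≡ wk (subst σ L)
subst-wk σ L = trans (subst-rename (exts σ) suc L) (sym (rename-subst suc σ L))

subst-subst : (σ : Fin m → Term k) (τ : Fin n → Term m) →
              subst σ ∘ subst τ ≗ subst (subst σ ∘ τ)
subst-subst σ τ (var i)   = refl
subst-subst σ τ (lam M)   =
  cong lam (trans (subst-subst (exts σ) (exts τ) M) (subst-cong exts-exts M))
  where
  exts-exts : subst (exts σ) ∘ exts τ ≗ exts (subst σ ∘ τ)
  exts-exts zero    = refl
  exts-exts (suc i) = subst-wk σ (τ i)
subst-subst σ τ (app M N) = cong₂ app (subst-subst σ τ M) (subst-subst σ τ N)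

subst-id : (M : Term n) → subst var M ≡ M
subst-id (var i)   = refl
subst-id (lam M)   = cong lam (trans (subst-cong exts-var M) (subst-id M))
  where
  exts-var : exts var ≗ var
  exts-var zero    = refl
  exts-var (suc i) = refl
subst-id (app M N) = cong₂ app (subst-id M) (subst-id N)

rename-·* : (ρ : Fin n → Fin m) (M : Term n) (Ms : List (Term n)) →
            rename ρ (M ·* Ms) ≡ (rename ρ M ·* map (rename ρ) Ms)
rename-·* ρ M []       = refl
rename-·* ρ M (N ∷ Ns) = rename-·* ρ (app M N) Ns

subst-·* : (σ : Fin n → Term m) (M : Term n) (Ms : List (Term n)) →
           subst σ (M ·* Ms) ≡ (subst σ M ·* map (subst σ) Ms)
subst-·* σ M []       = refl
subst-·* σ M (N ∷ Ns) = subst-·* σ (app M N) Ns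

β₀ : Term n → Fin (ℕ.suc n) → Term n
β₀ V zero    = V
β₀ V (suc i) = var i

[]₀-β₀ : (M : Term (ℕ.suc n)) (V : Term n) → (M [ V ]₀) ≡ subst (β₀ V) M
[]₀-β₀ M V = subst-cong (λ { zero → refl ; (suc i) → refl }) M

-- (M₀{V/0})ρ = (M₀ ρ⁺){Vρ/0}: both sides substitute V ρ for 0 and rename
-- the other variables by ρ.
rename-β : (ρ : Fin n → Fin m) (M : Term (ℕ.suc n)) (V : Term n) →
           rename ρ (M [ V ]₀) ≡ (rename (extr ρ) M [ rename ρ V ]₀)
rename-β ρ M V = begin
  rename ρ (M [ V ]₀)                   ≡⟨ cong (rename ρ) ([]₀-β₀ M V) ⟩
  rename ρ (subst (β₀ V) M)             ≡⟨ rename-subst ρ (β₀ V) M ⟩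
  subst (rename ρ ∘ β₀ V) M             ≡⟨ subst-cong pointwise M ⟩
  subst (β₀ (rename ρ V) ∘ extr ρ) M    ≡⟨ subst-rename (β₀ (rename ρ V)) (extr ρ) M ⟨
  subst (β₀ (rename ρ V)) (rename (extr ρ) M) ≡⟨ []₀-β₀ (rename (extr ρ) M) (rename ρ V) ⟨
  (rename (extr ρ) M [ rename ρ V ]₀)   ∎
  where
  open ≡-Reasoning
  pointwise : rename ρ ∘ β₀ V ≗ β₀ (rename ρ V) ∘ extr ρ
  pointwise zero    = refl
  pointwise (suc i) = refl

subst-β : (σ : Fin n → Term m) (M : Term (ℕ.suc n)) (V : Term n) →
          subst σ (M [ V ]₀) ≡ (subst (exts σ) M [ subst σ V ]₀)
subst-β σ M V = begin
  subst σ (M [ V ]₀)                    ≡⟨ cong (subst σ) ([]₀-β₀ M V) ⟩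
  subst σ (subst (β₀ V) M)              ≡⟨ subst-subst σ (β₀ V) M ⟩
  subst (subst σ ∘ β₀ V) M              ≡⟨ subst-cong pointwise M ⟩
  subst (subst τ ∘ exts σ) M            ≡⟨ subst-subst τ (exts σ) M ⟨
  subst τ (subst (exts σ) M)            ≡⟨ []₀-β₀ (subst (exts σ) M) (subst σ V) ⟨
  (subst (exts σ) M [ subst σ V ]₀)     ∎
  where
  open ≡-Reasoning
  τ : Fin (ℕ.suc _) → Term _
  τ = β₀ (subst σ V)
  -- on a successor both sides are σ i: the weakening is undone by τ
  pointwise : subst σ ∘ β₀ V ≗ subst τ ∘ exts σ
  pointwise zero    = refl
  pointwise (suc i) = sym (trans (subst-rename τ suc (σ i)) (subst-id (σ i)))

⇒-cast : {A A' B B' : Term n} → A ≡ A' → B ≡ B' → A ⇒ B → A' ⇒ B'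
⇒-cast = subst₂ _⇒_

rename-value : (ρ : Fin n → Fin m) {V : Term n} → Value V → Value (rename ρ V)
rename-value ρ (var x) = var (ρ x)
rename-value ρ (lam M) = lam _

-- Each rule instance is renamed to an instance of the same rule; its
-- endpoints are matched by the spine, β and weakening commutation laws.
mutual
  rename-⇒ : (ρ : Fin n → Fin m) {M M' : Term n} → M ⇒ M' → rename ρ M ⇒ rename ρ M'
  rename-⇒ ρ (βv {M₀' = M₀'} {V' = V'} {Ms} {Ms'} v rV r₀ rs) =
    ⇒-cast (sym (rename-·* ρ _ Ms))
           (sym (trans (rename-·* ρ _ Ms') (cong (_·* map (rename ρ) Ms') (rename-β ρ M₀' V'))))
           (βv (rename-value ρ v) (rename-⇒ ρ rV) (rename-⇒ (extr ρ) r₀) (rename-⇒* ρ rs))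
  rename-⇒ ρ (σ₁ {M₀' = M₀'} {N' = N'} {L' = L'} {Ms} {Ms'} rN rL r₀ rs) =
    ⇒-cast (sym (rename-·* ρ _ Ms))
           (sym (trans (rename-·* ρ _ Ms')
             (cong (λ X → app (lam (app (rename (extr ρ) M₀') X)) (rename ρ N') ·* map (rename ρ) Ms')
                   (rename-wk ρ L'))))
           (σ₁ (rename-⇒ ρ rN) (rename-⇒ ρ rL) (rename-⇒ (extr ρ) r₀) (rename-⇒* ρ rs))
  rename-⇒ ρ (σ₃ {V' = V'} {N' = N'} {L' = L'} {Ms} {Ms'} v rV rN rL rs) =
    ⇒-cast (sym (rename-·* ρ _ Ms))
           (sym (trans (rename-·* ρ _ Ms')
             (cong (λ X → app (lam (app X (rename (extr ρ) L'))) (rename ρ N') ·* map (rename ρ) Ms')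
                   (rename-wk ρ V'))))
           (σ₃ (rename-value ρ v) (rename-⇒ ρ rV) (rename-⇒ ρ rN) (rename-⇒ (extr ρ) rL)
               (rename-⇒* ρ rs))
  rename-⇒ ρ (lamR {Ms = Ms} {Ms'} r₀ rs) =
    ⇒-cast (sym (rename-·* ρ _ Ms)) (sym (rename-·* ρ _ Ms'))
           (lamR (rename-⇒ (extr ρ) r₀) (rename-⇒* ρ rs))
  rename-⇒ ρ (varR {Ms = Ms} {Ms'} rs) =
    ⇒-cast (sym (rename-·* ρ _ Ms)) (sym (rename-·* ρ _ Ms')) (varR (rename-⇒* ρ rs))

  rename-⇒* : (ρ : Fin n → Fin m) {Ms Ms' : List (Term n)} →
              Ms ⇒* Ms' → map (rename ρ) Ms ⇒* map (rename ρ) Ms'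
  rename-⇒* ρ []       = []
  rename-⇒* ρ (r ∷ rs) = rename-⇒ ρ r ∷ rename-⇒* ρ rs

-- V ⇒v V': V is a value and V' a parallel reduct of it (hence a value).
infix 4 _⇒v_ _⇒σ_

data _⇒v_ {n : ℕ} : Term n → Term n → Set where
  varV : ∀ {x} → var x ⇒v var x
  lamV : ∀ {P P'} → P ⇒ P' → lam P ⇒v lam P'

⇒v-value : {V V' : Term n} → V ⇒v V' → Value V
⇒v-value (varV {x})   = var x
⇒v-value (lamV {P} _) = lam P

rename-⇒v : (ρ : Fin n → Fin m) {V V' : Term n} → V ⇒v V' → rename ρ V ⇒v rename ρ V'
rename-⇒v ρ varV     = varV
rename-⇒v ρ (lamV r) = lamV (rename-⇒ (extr ρ) r)

⇒v-spine : {V V' : Term n} {Ms Ms' : List (Term n)} →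
           V ⇒v V' → Ms ⇒* Ms' → (V ·* Ms) ⇒ (V' ·* Ms')
⇒v-spine varV     rs = varR rs
⇒v-spine (lamV r) rs = lamR r rs

_⇒σ_ : (σ σ' : Fin n → Term m) → Set
σ ⇒σ σ' = ∀ i → σ i ⇒v σ' i

-- relatedness survives lifting under a binder (this is where renaming
-- stability is needed)
exts-⇒σ : {σ σ' : Fin n → Term m} → σ ⇒σ σ' → exts σ ⇒σ exts σ'
exts-⇒σ h zero    = varV
exts-⇒σ h (suc i) = rename-⇒v suc (h i)

subst-value : {σ σ' : Fin n → Term m} → σ ⇒σ σ' → {V : Term n} → Value V → Value (subst σ V)
subst-value h (var x) = ⇒v-value (h x)
subst-value h (lam M) = lam _

-- As for renaming, with related substitutions in place of ρ; the only new
-- case is a head variable, which becomes a related pair of values.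
mutual
  subst-⇒ : {σ σ' : Fin n → Term m} → σ ⇒σ σ' →
            {M M' : Term n} → M ⇒ M' → subst σ M ⇒ subst σ' M'
  subst-⇒ {σ = σ} {σ'} h (βv {M₀' = M₀'} {V' = V'} {Ms} {Ms'} v rV r₀ rs) =
    ⇒-cast (sym (subst-·* σ _ Ms))
           (sym (trans (subst-·* σ' _ Ms') (cong (_·* map (subst σ') Ms') (subst-β σ' M₀' V'))))
           (βv (subst-value h v) (subst-⇒ h rV) (subst-⇒ (exts-⇒σ h) r₀) (subst-⇒* h rs))
  subst-⇒ {σ = σ} {σ'} h (σ₁ {M₀' = M₀'} {N' = N'} {L' = L'} {Ms} {Ms'} rN rL r₀ rs) =
    ⇒-cast (sym (subst-·* σ _ Ms))
           (sym (trans (subst-·* σ' _ Ms')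
             (cong (λ X → app (lam (app (subst (exts σ') M₀') X)) (subst σ' N') ·* map (subst σ') Ms')
                   (subst-wk σ' L'))))
           (σ₁ (subst-⇒ h rN) (subst-⇒ h rL) (subst-⇒ (exts-⇒σ h) r₀) (subst-⇒* h rs))
  subst-⇒ {σ = σ} {σ'} h (σ₃ {V' = V'} {N' = N'} {L' = L'} {Ms} {Ms'} v rV rN rL rs) =
    ⇒-cast (sym (subst-·* σ _ Ms))
           (sym (trans (subst-·* σ' _ Ms')
             (cong (λ X → app (lam (app X (subst (exts σ') L'))) (subst σ' N') ·* map (subst σ') Ms')
                   (subst-wk σ' V'))))
           (σ₃ (subst-value h v) (subst-⇒ h rV) (subst-⇒ h rN) (subst-⇒ (exts-⇒σ h) rL)
               (subst-⇒* h rs))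
  subst-⇒ {σ = σ} {σ'} h (lamR {Ms = Ms} {Ms'} r₀ rs) =
    ⇒-cast (sym (subst-·* σ _ Ms)) (sym (subst-·* σ' _ Ms'))
           (lamR (subst-⇒ (exts-⇒σ h) r₀) (subst-⇒* h rs))
  subst-⇒ {σ = σ} {σ'} h (varR {x = x} {Ms} {Ms'} rs) =
    ⇒-cast (sym (subst-·* σ _ Ms)) (sym (subst-·* σ' _ Ms'))
           (⇒v-spine (h x) (subst-⇒* h rs))

  subst-⇒* : {σ σ' : Fin n → Term m} → σ ⇒σ σ' →
             {Ms Ms' : List (Term n)} → Ms ⇒* Ms' → map (subst σ) Ms ⇒* map (subst σ') Ms'
  subst-⇒* h []       = []
  subst-⇒* h (r ∷ rs) = subst-⇒ h r ∷ subst-⇒* h rs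

⇒v-int : {V V' : Term n} → V ⇒v V' → V ⇒int V'
⇒v-int varV     = varI
⇒v-int (lamV r) = lamI r

subst-⇒int : {σ σ' : Fin n → Term m} → σ ⇒σ σ' →
             {M M' : Term n} → M ⇒int M' → subst σ M ⇒int subst σ' M'
subst-⇒int h (lamI r)      = lamI (subst-⇒ (exts-⇒σ h) r)
subst-⇒int h (varI {x})    = ⇒v-int (h x)
subst-⇒int {σ = σ} {σ'} h (appI {Ms = Ms} {Ms'} v rV rN rs) =
  subst₂ _⇒int_ (sym (subst-·* σ _ Ms)) (sym (subst-·* σ' _ Ms'))
         (appI (subst-value h v) (subst-⇒ h rV) (subst-⇒int h rN) (subst-⇒* h rs))

spine-not-value : (P Q : Term n) (Ms : List (Term n)) → Value (app P Q ·* Ms) → ⊥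
spine-not-value P Q []       ()
spine-not-value P Q (M ∷ Ms) v = spine-not-value (app P Q) M Ms v

value-⇒int : {V V' : Term n} → Value V → V ⇒int V' → V ⇒v V'
value-⇒int v (lamI r) = lamV r
value-⇒int v varI     = varV
value-⇒int v (appI {V = P} {N = Q} {Ms = Ms} _ _ _ _) with () ← spine-not-value P Q Ms v

single-⇒σ : {V V' : Term n} (x : Fin n) → V ⇒v V' → single V x ⇒σ single V' x
single-⇒σ x h i with i ≟ x
... | yes _ = h
... | no  _ = varV

lemma3p14 : ∀ {n : ℕ} (M M' V V' : Term n) (x : Fin n) →
    Value V → Value V' → M ⇒int M' → V ⇒int V' →
    (M [ V / x ]) ⇒int (M' [ V' / x ])
lemma3p14 M M' V V' x vV _ rM rV =
  subst-⇒int (single-⇒σ x (value-⇒int vV rV)) rM
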